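{- For all positive integers $n,f,L$ with $L\ge 2$, there is an $n$-vertex graph $G$ such that any $(L,f)$-replacement path covering for $G$ has covering value at least $$\min\Big\{\sum_{i=0}^{f-1}\binom{L-2}{i},\ n\Big\}.$$
   Context: Graphs may be directed and edge-weighted. For a graph $G=(V,E)$ and $F\subseteq E$, $G-F$ denotes $G$ with the edges of $F$ removed. An $(L,f)$-replacement path covering for $G$ is a family $\mathcal{G}$ of spanning subgraphs of $G$ together with, for every set $F\subseteq E$ with $|F|\le f$, a subfamily $\mathcal{G}_F\subseteq\mathcal{G}$ such that: (1) no subgraph in $\mathcal{G}_F$ contains an edge of $F$; (2) for all $s,t\in V$ such that there exists a shortest path from $s$ to $t$ in $G-F$ with at most $L$ edges, at least one subgraph in $\mathcal{G}_F$ also contains such a path. The covering value is $|\mathcal{G}|$. -}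

module Defs where

open import Data.Nat using (ℕ; zero; suc; _+_; _≤_; _∸_; _⊓_)
open import Data.Nat.Combinatorics using (_C_)
open import Data.Fin using (Fin)
open import Data.Fin.Subset using (Subset; _∈_; _∉_; ∁; ∣_∣)
open import Data.List using (List; []; _∷_; length; map; upTo)
open import Data.Nat.ListAction using (sum)
open import Data.List.Relation.Unary.All using (All)
open import Data.Product using (Σ; ∃; _×_)
open import Relation.Binary.PropositionalEquality using (_≡_)

record Graph (n : ℕ) : Set where
  field
    m      : ℕ
    src    : Fin m → Fin n
    tgt    : Fin m → Fin n
    weight : Fin m → ℕ
    weight-pos : ∀ e → 1 ≤ weight e

open Graph public

IsWalk : ∀ {n} (G : Graph n) → Fin n → Fin n → List (Fin (m G)) → Set
IsWalk G s t []       = s ≡ t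
IsWalk G s t (e ∷ es) = (src G e ≡ s) × IsWalk G (tgt G e) t es

walkWeight : ∀ {n} (G : Graph n) → List (Fin (m G)) → ℕ
walkWeight G []       = 0
walkWeight G (e ∷ es) = weight G e + walkWeight G es

PathIn : ∀ {n} (G : Graph n) → Subset (m G) → Fin n → Fin n → List (Fin (m G)) → Set
PathIn G H s t p = IsWalk G s t p × All (_∈ H) p

ShortestIn : ∀ {n} (G : Graph n) → Subset (m G) → Fin n → Fin n → List (Fin (m G)) → Set
ShortestIn G H s t p =
  PathIn G H s t p × (∀ q → PathIn G H s t q → walkWeight G p ≤ walkWeight G q)

-- The edge set of G - F is the complement ∁ F.
-- An (L,f)-replacement path covering given as a family 𝒢 : Fin k → Subset (m G)
-- of spanning subgraphs (by their edge sets); its covering value is k.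
IsRPCovering : ∀ {n} (G : Graph n) (L f k : ℕ) → (Fin k → Subset (m G)) → Set
IsRPCovering G L f k 𝒢 =
  ∀ (F : Subset (m G)) → ∣ F ∣ ≤ f →
  Σ (Subset k) λ 𝒢F →
    (∀ i → i ∈ 𝒢F → ∀ e → e ∈ F → e ∉ 𝒢 i)
    × (∀ s t →
        (∃ λ p → ShortestIn G (∁ F) s t p × length p ≤ L) →
        ∃ λ i → i ∈ 𝒢F ×
          (∃ λ p → ShortestIn G (∁ F) s t p × length p ≤ L × All (_∈ 𝒢 i) p))

binomSum : ℕ → ℕ → ℕ
binomSum L f = sum (map (λ i → (L ∸ 2) C i) (upTo f))

{-# OPTIONS --safe #-}
-- The graph is the path 0 — 1 — ⋯ — N (so n = N + 1) with every step l → l + 1 doubled: a light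
-- edge of weight 1 and a heavy edge of weight 2.  Let p = min (L − 2, N) and fail the light edges
-- at a set S of at most f − 1 positions below p.  The prefix cost v ↦ Σ_{l<v} (2 if l ∈ S else 1)
-- is a feasible potential of G − F, so no walk from 0 to p weighs less than the cost of p, and a
-- walk of exactly that weight never takes a heavy edge at a position outside S.  The canonical
-- path (heavy exactly at S, p ≤ L edges) has that weight, so every shortest 0–p path takes the
-- light edge at each position outside S.  A member of 𝒢_F carrying such a path contains these
-- light edges and misses the failed ones, so S can be read off from it.  Distinct S thus need
-- distinct members, and there are Σ_{i<f} C(p, i) ≥ min (Σ_{i<f} C(L − 2, i), n) such S.
module Submission where

open import Defs
open import Data.Nat using (ℕ; zero; suc; _+_; _≤_; _<_; _⊓_; z≤n; s≤s)
open import Data.Nat.Properties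
  using ( ≤-refl; ≤-reflexive; ≤-trans; ≤-total; <⇒≤; <-irrefl; <⇒≱; ≤∧≢⇒<; n≤1+n; m≤m+n; m≤n+m; m+n≤o⇒m≤o
        ; +-assoc; +-suc; +-identityʳ; +-mono-≤; +-monoˡ-≤; +-monoʳ-≤; +-monoˡ-<; +-monoʳ-<; +-cancelˡ-≤
        ; +-commutativeSemigroup; m⊓n≤m; m⊓n≤n; m≤n⇒m⊓n≡m; m≥n⇒m⊓n≡n; module ≤-Reasoning )
open import Data.Nat.Combinatorics using (_C_; nCk+nC[k+1]≡[n+1]C[k+1])
open import Data.Nat.ListAction using (sum)
open import Algebra.Properties.CommutativeSemigroup +-commutativeSemigroup using (interchange)
open import Data.Bool using (not)
open import Data.List using (List; []; _∷_; map; length; upTo)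
open import Data.List.Properties using (map-applyUpTo; map-cong; length-map)
open import Data.List.Relation.Unary.All as All using (All; []; _∷_)
open import Data.List.Relation.Unary.All.Properties using (map⁺)
open import Data.List.Relation.Unary.Any as Any using (Any; here; there)
open import Data.List.Relation.Unary.Any.Properties using (Any-⊎⁻)
open import Data.List.Membership.Propositional using () renaming (_∈_ to _∈ₗ_)
open import Data.Fin using (Fin; zero; suc; toℕ; inject₁; inject≤; fromℕ<; splitAt; join; _↑ˡ_; _↑ʳ_; _≟_)
open import Data.Fin.Properties
  using ( toℕ-injective; toℕ-inject₁; toℕ-inject≤; toℕ-fromℕ<; toℕ<n; toℕ≤pred[n]
        ; splitAt-↑ˡ; splitAt-↑ʳ; join-splitAt; injective⇒≤ )
open import Data.Fin.Subset using (Side; Subset; inside; outside; _∈_; _∉_; ∁; ∣_∣; ⊥)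
open import Data.Fin.Subset.Properties using (∣⊥∣≡0; x∈∁p⇒x∉p; x∉p⇒x∈∁p)
open import Data.Vec using (Vec; []; _∷_; _++_; lookup; tabulate; padRight)
open import Data.Vec.Properties
  using ( lookup-++ˡ; lookup-++ʳ; lookup-replicate; []=⇒lookup; lookup⇒[]=; tabulate-cong; tabulate∘lookup
        ; ∷-injectiveˡ; ∷-injectiveʳ )
open import Data.Sum using (_⊎_; inj₁; inj₂; [_,_]′)
open import Data.Product using (Σ; ∃; _,_; proj₁; proj₂)
open import Data.Empty using (⊥-elim)
open import Function using (_∘_; id; const)
open import Function.Definitions using (Injective)
open import Relation.Nullary using (¬_; yes; no)
open import Relation.Binary.PropositionalEquality
  using (_≡_; _≢_; refl; sym; trans; cong; cong₂; subst; subst₂; module ≡-Reasoning)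

inside≢outside : inside ≢ outside
inside≢outside ()

lookup-∉ : ∀ {n} {x : Fin n} {H : Subset n} → x ∉ H → lookup H x ≡ outside
lookup-∉ {x = x} {H} x∉H with lookup H x in H[x]
... | inside  = ⊥-elim (x∉H (lookup⇒[]= x H H[x]))
... | outside = refl

∈∁⇒lookup≡outside : ∀ {n} {x : Fin n} {H : Subset n} → x ∈ ∁ H → lookup H x ≡ outside
∈∁⇒lookup≡outside = lookup-∉ ∘ x∈∁p⇒x∉p

lookup≡outside⇒∈∁ : ∀ {n} {x : Fin n} {H : Subset n} → lookup H x ≡ outside → x ∈ ∁ H
lookup≡outside⇒∈∁ H[x] = x∉p⇒x∈∁p (λ x∈H → inside≢outside (trans (sym ([]=⇒lookup x∈H)) H[x]))

∣p++⊥∣≡∣p∣ : ∀ {m n} (p : Subset m) → ∣ p ++ ⊥ {n} ∣ ≡ ∣ p ∣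
∣p++⊥∣≡∣p∣ {n = n} []    = ∣⊥∣≡0 n
∣p++⊥∣≡∣p∣ (inside  ∷ p) = cong suc (∣p++⊥∣≡∣p∣ p)
∣p++⊥∣≡∣p∣ (outside ∷ p) = ∣p++⊥∣≡∣p∣ p

∣padRight∣≡∣p∣ : ∀ {m n} (m≤n : m ≤ n) (p : Subset m) → ∣ padRight m≤n outside p ∣ ≡ ∣ p ∣
∣padRight∣≡∣p∣ {n = n} z≤n []      = ∣⊥∣≡0 n
∣padRight∣≡∣p∣ (s≤s m≤n) (inside  ∷ p) = cong suc (∣padRight∣≡∣p∣ m≤n p)
∣padRight∣≡∣p∣ (s≤s m≤n) (outside ∷ p) = ∣padRight∣≡∣p∣ m≤n p

lookup-padRight : ∀ {a} {A : Set a} {m n} (m≤n : m ≤ n) (x : A) (xs : Vec A m) (i : Fin m) →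
                  lookup (padRight m≤n x xs) (inject≤ i m≤n) ≡ lookup xs i
lookup-padRight (s≤s m≤n) x (y ∷ xs) zero    = refl
lookup-padRight (s≤s m≤n) x (y ∷ xs) (suc i) = lookup-padRight m≤n x xs i

splitAt-injective : ∀ m {n} → Injective _≡_ _≡_ (splitAt m {n})
splitAt-injective m {n} {i} {j} eq =
  trans (sym (join-splitAt m n i)) (trans (cong (join m n) eq) (join-splitAt m n j))

[,]-injective : ∀ {a b c} {A : Set a} {B : Set b} {C : Set c} {f : A → C} {g : B → C} →
                Injective _≡_ _≡_ f → Injective _≡_ _≡_ g → (∀ x y → f x ≢ g y) →
                Injective _≡_ _≡_ [ f , g ]′
[,]-injective f-inj g-inj f≢g {inj₁ x} {inj₁ y} eq = cong inj₁ (f-inj eq)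
[,]-injective f-inj g-inj f≢g {inj₁ x} {inj₂ y} eq = ⊥-elim (f≢g x y eq)
[,]-injective f-inj g-inj f≢g {inj₂ x} {inj₁ y} eq = ⊥-elim (f≢g y x (sym eq))
[,]-injective f-inj g-inj f≢g {inj₂ x} {inj₂ y} eq = cong inj₂ (g-inj eq)

sum-upTo-suc : ∀ (g : ℕ → ℕ) n → sum (map g (upTo (suc n))) ≡ g 0 + sum (map (g ∘ suc) (upTo n))
sum-upTo-suc g n =
  cong (λ xs → g 0 + sum xs) (trans (map-applyUpTo suc g n) (sym (map-applyUpTo id (g ∘ suc) n)))

sum-map-+ : ∀ (g h : ℕ → ℕ) xs → sum (map (λ i → g i + h i) xs) ≡ sum (map g xs) + sum (map h xs)
sum-map-+ g h []       = refl
sum-map-+ g h (x ∷ xs) = trans (cong (g x + h x +_) (sum-map-+ g h xs)) (interchange (g x) (h x) _ _)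

sum-map-zero : ∀ (xs : List ℕ) → sum (map (const 0) xs) ≡ 0
sum-map-zero []       = refl
sum-map-zero (x ∷ xs) = sum-map-zero xs

atMost : ℕ → ℕ → ℕ
atMost zero    c       = 1
atMost (suc p) zero    = atMost p zero
atMost (suc p) (suc c) = atMost p c + atMost p (suc c)

enumAtMost : ∀ p c → Fin (atMost p c) → Subset p
enumAtMost zero    c       _ = []
enumAtMost (suc p) zero    i = outside ∷ enumAtMost p zero i
enumAtMost (suc p) (suc c) i =
  [ (inside ∷_) ∘ enumAtMost p c , (outside ∷_) ∘ enumAtMost p (suc c) ]′ (splitAt (atMost p c) i)

enumAtMost-injective : ∀ p c → Injective _≡_ _≡_ (enumAtMost p c)
enumAtMost-injective zero    c       {zero} {zero} _ = refl
enumAtMost-injective (suc p) zero    eq = enumAtMost-injective p zero (∷-injectiveʳ eq)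
enumAtMost-injective (suc p) (suc c) eq = splitAt-injective (atMost p c)
  ([,]-injective (enumAtMost-injective p c ∘ ∷-injectiveʳ) (enumAtMost-injective p (suc c) ∘ ∷-injectiveʳ)
                 (λ _ _ eq′ → inside≢outside (∷-injectiveˡ eq′)) eq)

∣enumAtMost∣≤ : ∀ p c i → ∣ enumAtMost p c i ∣ ≤ c
∣enumAtMost∣≤ zero    c       _ = z≤n
∣enumAtMost∣≤ (suc p) zero    i = ∣enumAtMost∣≤ p zero i
∣enumAtMost∣≤ (suc p) (suc c) i with splitAt (atMost p c) i
... | inj₁ j = s≤s (∣enumAtMost∣≤ p c j)
... | inj₂ j = ∣enumAtMost∣≤ p (suc c) j

atMost-zero : ∀ p → atMost p zero ≡ 1
atMost-zero zero    = refl
atMost-zero (suc p) = atMost-zero p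

atMost-positive : ∀ p c → 1 ≤ atMost p c
atMost-positive zero    c       = ≤-refl
atMost-positive (suc p) zero    = atMost-positive p zero
atMost-positive (suc p) (suc c) = ≤-trans (atMost-positive p c) (m≤m+n _ _)

suc≤atMost : ∀ p c → suc p ≤ atMost p (suc c)
suc≤atMost zero    c = ≤-refl
suc≤atMost (suc p) c = +-mono-≤ (atMost-positive p c) (suc≤atMost p c)

atMost≡Σbinomial : ∀ p c → atMost p c ≡ sum (map (p C_) (upTo (suc c)))
atMost≡Σbinomial zero    c       = sym (trans (sum-upTo-suc (0 C_) c) (cong suc (sum-map-zero (upTo c))))
atMost≡Σbinomial (suc p) zero    = atMost-zero p
atMost≡Σbinomial (suc p) (suc c) = begin
  atMost p c + atMost p (suc c)            ≡⟨ cong₂ _+_ (atMost≡Σbinomial p c) (atMost≡Σbinomial p (suc c)) ⟩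
  B p c + B p (suc c)                      ≡⟨ cong (B p c +_) (sum-upTo-suc (p C_) (suc c)) ⟩
  B p c + suc (∑ (λ i → p C suc i))        ≡⟨ +-suc (B p c) _ ⟩
  suc (B p c + ∑ (λ i → p C suc i))        ≡⟨ cong suc (sum-map-+ (p C_) (λ i → p C suc i) (upTo (suc c))) ⟨
  suc (∑ (λ i → p C i + p C suc i))        ≡⟨ cong (suc ∘ sum) (map-cong (nCk+nC[k+1]≡[n+1]C[k+1] p) (upTo (suc c))) ⟩
  suc (∑ (λ i → suc p C suc i))            ≡⟨ sum-upTo-suc (suc p C_) (suc c) ⟨
  B (suc p) (suc c)                        ∎
  where
  open ≡-Reasoning
  B : ℕ → ℕ → ℕ
  B q d = sum (map (q C_) (upTo (suc d)))
  ∑ : (ℕ → ℕ) → ℕ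
  ∑ g = sum (map g (upTo (suc c)))

Σbinomial⊓suc≤atMost : ∀ q N c → sum (map (q C_) (upTo (suc c))) ⊓ suc N ≤ atMost (q ⊓ N) c
Σbinomial⊓suc≤atMost q N zero =
  ≤-trans (m⊓n≤m (sum (map (q C_) (upTo 1))) (suc N)) (≤-reflexive (sym (atMost-zero (q ⊓ N))))
Σbinomial⊓suc≤atMost q N (suc c) with ≤-total q N
... | inj₁ q≤N rewrite m≤n⇒m⊓n≡m q≤N = ≤-trans (m⊓n≤m _ _) (≤-reflexive (sym (atMost≡Σbinomial q (suc c))))
... | inj₂ N≤q rewrite m≥n⇒m⊓n≡n N≤q = ≤-trans (m⊓n≤n _ _) (suc≤atMost N c)

module Potential {n} (G : Graph n) (φ : Fin n → ℕ) where

  Feasible Tight Strict : Fin (m G) → Set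
  Feasible e = φ (tgt G e) ≤ φ (src G e) + weight G e
  Tight    e = φ (src G e) + weight G e ≡ φ (tgt G e)
  Strict   e = φ (tgt G e) < φ (src G e) + weight G e

  walkWeight-tight : ∀ {s t} q → IsWalk G s t q → All Tight q → φ s + walkWeight G q ≡ φ t
  walkWeight-tight []                refl       []                  = +-identityʳ _
  walkWeight-tight {t = t} (e ∷ q) (refl , w) (e-tight ∷ q-tight) = begin
    φ (src G e) + (weight G e + walkWeight G q) ≡⟨ +-assoc (φ (src G e)) (weight G e) (walkWeight G q) ⟨
    φ (src G e) + weight G e + walkWeight G q   ≡⟨ cong (_+ walkWeight G q) e-tight ⟩
    φ (tgt G e) + walkWeight G q                ≡⟨ walkWeight-tight q w q-tight ⟩
    φ t                                         ∎
    where open ≡-Reasoning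

  walkWeight-feasible : ∀ {s t} q → IsWalk G s t q → All Feasible q → φ t ≤ φ s + walkWeight G q
  walkWeight-feasible []                refl       []                        = m≤m+n _ 0
  walkWeight-feasible {t = t} (e ∷ q) (refl , w) (e-feasible ∷ q-feasible) = begin
    φ t                                         ≤⟨ walkWeight-feasible q w q-feasible ⟩
    φ (tgt G e) + walkWeight G q                ≤⟨ +-monoˡ-≤ _ e-feasible ⟩
    φ (src G e) + weight G e + walkWeight G q   ≡⟨ +-assoc (φ (src G e)) (weight G e) (walkWeight G q) ⟩
    φ (src G e) + (weight G e + walkWeight G q) ∎
    where open ≤-Reasoning

  walkWeight-strict : ∀ {s t} q → IsWalk G s t q → All Feasible q → Any Strict q → φ t < φ s + walkWeight G q
  walkWeight-strict {t = t} (e ∷ q) (refl , w) (_ ∷ q-feasible) (here e-strict) = begin-strict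
    φ t                                         ≤⟨ walkWeight-feasible q w q-feasible ⟩
    φ (tgt G e) + walkWeight G q                <⟨ +-monoˡ-< _ e-strict ⟩
    φ (src G e) + weight G e + walkWeight G q   ≡⟨ +-assoc (φ (src G e)) (weight G e) (walkWeight G q) ⟩
    φ (src G e) + (weight G e + walkWeight G q) ∎
    where open ≤-Reasoning
  walkWeight-strict {t = t} (e ∷ q) (refl , w) (e-feasible ∷ q-feasible) (there q-strict) = begin-strict
    φ t                                         <⟨ walkWeight-strict q w q-feasible q-strict ⟩
    φ (tgt G e) + walkWeight G q                ≤⟨ +-monoˡ-≤ _ e-feasible ⟩
    φ (src G e) + weight G e + walkWeight G q   ≡⟨ +-assoc (φ (src G e)) (weight G e) (walkWeight G q) ⟩
    φ (src G e) + (weight G e + walkWeight G q) ∎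
    where open ≤-Reasoning

  module _ {H : Subset (m G)} (H-feasible : ∀ {e} → e ∈ H → Feasible e) where

    tight⇒shortest : ∀ {s t q} → PathIn G H s t q → All Tight q → ShortestIn G H s t q
    tight⇒shortest {s} {t} {q} (w , q⊆H) q-tight = (w , q⊆H) , λ q′ (w′ , q′⊆H) →
      +-cancelˡ-≤ (φ s) _ _ (begin
        φ s + walkWeight G q  ≡⟨ walkWeight-tight q w q-tight ⟩
        φ t                   ≤⟨ walkWeight-feasible q′ w′ (All.map H-feasible q′⊆H) ⟩
        φ s + walkWeight G q′ ∎)
      where open ≤-Reasoning

    shortest⇒¬strict : ∀ {s t q q′} → ShortestIn G H s t q → PathIn G H s t q′ → All Tight q′ →
                       ¬ Any Strict q
    shortest⇒¬strict {s} {t} {q} {q′} ((w , q⊆H) , q-min) q′-path q′-tight q-strict = <-irrefl refl (begin-strict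
      φ t                   <⟨ walkWeight-strict q w (All.map H-feasible q⊆H) q-strict ⟩
      φ s + walkWeight G q  ≤⟨ +-monoʳ-≤ (φ s) (q-min q′ q′-path) ⟩
      φ s + walkWeight G q′ ≡⟨ walkWeight-tight q′ (proj₁ q′-path) q′-tight ⟩
      φ t                   ∎)
      where open ≤-Reasoning

cost : Side → ℕ
cost inside  = 2
cost outside = 1

prefixCost : ∀ {N} → Subset N → Fin (suc N) → ℕ
prefixCost T       zero    = 0
prefixCost (b ∷ T) (suc v) = cost b + prefixCost T v

prefixCost-suc : ∀ {N} (T : Subset N) l → prefixCost T (suc l) ≡ prefixCost T (inject₁ l) + cost (lookup T l)
prefixCost-suc (b ∷ T) zero    = +-identityʳ (cost b)
prefixCost-suc (b ∷ T) (suc l) = trans (cong (cost b +_) (prefixCost-suc T l)) (sym (+-assoc (cost b) _ _))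

module DoubledPath (N : ℕ) where

  light heavy : Fin N → Fin (N + N)
  light l = l ↑ˡ N
  heavy l = N ↑ʳ l

  position : Fin (N + N) → Fin N
  position e = [ id , id ]′ (splitAt N e)

  edgeWeight : Fin (N + N) → ℕ
  edgeWeight e = [ const 1 , const 2 ]′ (splitAt N e)

  edgeWeight-positive : ∀ e → 1 ≤ edgeWeight e
  edgeWeight-positive e with splitAt N e
  ... | inj₁ _ = s≤s z≤n
  ... | inj₂ _ = s≤s z≤n

  doubledPath : Graph (suc N)
  doubledPath = record
    { m = N + N ; src = inject₁ ∘ position ; tgt = suc ∘ position
    ; weight = edgeWeight ; weight-pos = edgeWeight-positive }

  data EdgeView : Fin (N + N) → Set where
    light-view : ∀ l → EdgeView (light l)
    heavy-view : ∀ l → EdgeView (heavy l)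

  edgeView : ∀ e → EdgeView e
  edgeView e with splitAt N e | join-splitAt N N e
  ... | inj₁ l | refl = light-view l
  ... | inj₂ l | refl = heavy-view l

  position-light : ∀ l → position (light l) ≡ l
  position-light l = cong [ id , id ]′ (splitAt-↑ˡ N l N)

  position-heavy : ∀ l → position (heavy l) ≡ l
  position-heavy l = cong [ id , id ]′ (splitAt-↑ʳ N N l)

  edgeWeight-light : ∀ l → edgeWeight (light l) ≡ 1
  edgeWeight-light l = cong [ const 1 , const 2 ]′ (splitAt-↑ˡ N l N)

  edgeWeight-heavy : ∀ l → edgeWeight (heavy l) ≡ 2
  edgeWeight-heavy l = cong [ const 1 , const 2 ]′ (splitAt-↑ʳ N N l)

  crosses : ∀ {s t} q → IsWalk doubledPath s t q → ∀ l → toℕ s ≤ toℕ l → toℕ l < toℕ t →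
            Any (λ e → position e ≡ l) q
  crosses []      refl       l s≤l l<s = ⊥-elim (<⇒≱ l<s s≤l)
  crosses (e ∷ q) (refl , w) l s≤l l<t with position e ≟ l
  ... | yes e-at-l    = here e-at-l
  ... | no  e-not-at-l = there (crosses q w l next≤l l<t)
    where
    next≤l : suc (toℕ (position e)) ≤ toℕ l
    next≤l = ≤∧≢⇒< (subst (_≤ toℕ l) (toℕ-inject₁ (position e)) s≤l) (e-not-at-l ∘ toℕ-injective)

  private
    shift-≤ : ∀ {j d} → j + suc d ≤ N → suc j + d ≤ N
    shift-≤ {j} {d} = subst (_≤ N) (+-suc j d)

    head-< : ∀ {j d} → j + suc d ≤ N → j < N
    head-< {j} = m+n≤o⇒m≤o (suc j) ∘ shift-≤

  positionsFrom : (j d : ℕ) → j + d ≤ N → List (Fin N)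
  positionsFrom j zero    _ = []
  positionsFrom j (suc d) b = fromℕ< (head-< b) ∷ positionsFrom (suc j) d (shift-≤ b)

  length-positionsFrom : ∀ j d b → length (positionsFrom j d b) ≡ d
  length-positionsFrom j zero    _ = refl
  length-positionsFrom j (suc d) b = cong suc (length-positionsFrom (suc j) d (shift-≤ b))

  positionsFrom-walk : (edge : Fin N → Fin (N + N)) → (∀ l → position (edge l) ≡ l) →
                       ∀ j d b {u t} → toℕ u ≡ j → toℕ t ≡ j + d →
                       IsWalk doubledPath u t (map edge (positionsFrom j d b))
  positionsFrom-walk edge position-edge j zero _ u≡j t≡j+0 =
    toℕ-injective (trans u≡j (trans (sym (+-identityʳ j)) (sym t≡j+0)))
  positionsFrom-walk edge position-edge j (suc d) b {u} u≡j t≡j+d =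
    toℕ-injective src≡u ,
    positionsFrom-walk edge position-edge (suc j) d (shift-≤ b) (cong suc position≡j) (trans t≡j+d (+-suc j d))
    where
    l : Fin N
    l = fromℕ< (head-< b)
    position≡j : toℕ (position (edge l)) ≡ j
    position≡j = trans (cong toℕ (position-edge l)) (toℕ-fromℕ< (head-< b))
    src≡u : toℕ (inject₁ (position (edge l))) ≡ toℕ u
    src≡u = trans (toℕ-inject₁ _) (trans position≡j (sym u≡j))

  faults : Subset N → Subset (N + N)
  faults T = T ++ ⊥

  module _ (T : Subset N) where

    open Potential doubledPath (prefixCost T)

    lookup-faults-light : ∀ l → lookup (faults T) (light l) ≡ lookup T l
    lookup-faults-light l = lookup-++ˡ T ⊥ l

    lookup-faults-heavy : ∀ l → lookup (faults T) (heavy l) ≡ outside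
    lookup-faults-heavy l = trans (lookup-++ʳ T ⊥ l) (lookup-replicate l outside)

    light-tight : ∀ {l} → lookup T l ≡ outside → Tight (light l)
    light-tight {l} T[l] rewrite position-light l | edgeWeight-light l | prefixCost-suc T l | T[l] = refl

    heavy-tight : ∀ {l} → lookup T l ≡ inside → Tight (heavy l)
    heavy-tight {l} T[l] rewrite position-heavy l | edgeWeight-heavy l | prefixCost-suc T l | T[l] = refl

    heavy-strict : ∀ {l} → lookup T l ≡ outside → Strict (heavy l)
    heavy-strict {l} T[l] rewrite position-heavy l | edgeWeight-heavy l | prefixCost-suc T l | T[l] =
      +-monoʳ-< (prefixCost T (inject₁ l)) ≤-refl

    feasible : ∀ {e} → e ∈ ∁ (faults T) → Feasible e
    feasible {e} e∉faults with edgeView e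
    ... | light-view l =
      ≤-reflexive (sym (light-tight (trans (sym (lookup-faults-light l)) (∈∁⇒lookup≡outside e∉faults))))
    ... | heavy-view l with lookup T l in T[l]
    ...   | inside  = ≤-reflexive (sym (heavy-tight T[l]))
    ...   | outside = <⇒≤ (heavy-strict T[l])

    bestEdge : Fin N → Fin (N + N)
    bestEdge l with lookup T l
    ... | inside  = heavy l
    ... | outside = light l

    position-bestEdge : ∀ l → position (bestEdge l) ≡ l
    position-bestEdge l with lookup T l
    ... | inside  = position-heavy l
    ... | outside = position-light l

    bestEdge-tight : ∀ l → Tight (bestEdge l)
    bestEdge-tight l with lookup T l in T[l]
    ... | inside  = heavy-tight T[l]
    ... | outside = light-tight T[l]

    bestEdge∉faults : ∀ l → bestEdge l ∈ ∁ (faults T)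
    bestEdge∉faults l with lookup T l in T[l]
    ... | inside  = lookup≡outside⇒∈∁ (lookup-faults-heavy l)
    ... | outside = lookup≡outside⇒∈∁ (trans (lookup-faults-light l) T[l])

    canonical : Fin (suc N) → List (Fin (N + N))
    canonical t = map bestEdge (positionsFrom 0 (toℕ t) (toℕ≤pred[n] t))

    length-canonical : ∀ t → length (canonical t) ≡ toℕ t
    length-canonical t = trans (length-map bestEdge (positionsFrom 0 (toℕ t) _)) (length-positionsFrom 0 (toℕ t) _)

    canonical-path : ∀ t → PathIn doubledPath (∁ (faults T)) zero t (canonical t)
    canonical-path t =
      positionsFrom-walk bestEdge position-bestEdge 0 (toℕ t) _ refl refl , map⁺ (All.universal bestEdge∉faults _)

    canonical-tight : ∀ t → All Tight (canonical t)
    canonical-tight t = map⁺ (All.universal bestEdge-tight _)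

    canonical-shortest : ∀ t → ShortestIn doubledPath (∁ (faults T)) zero t (canonical t)
    canonical-shortest t = tight⇒shortest feasible (canonical-path t) (canonical-tight t)

    shortest-uses-light : ∀ {t q} → ShortestIn doubledPath (∁ (faults T)) zero t q →
                          ∀ l → toℕ l < toℕ t → lookup T l ≡ outside → light l ∈ₗ q
    shortest-uses-light {t} {q} q-shortest l l<t T[l] =
      [ id , ⊥-elim ∘ shortest⇒¬strict feasible q-shortest (canonical-path t) (canonical-tight t) ]′
        (Any-⊎⁻ (Any.map lightOrStrict (crosses q (proj₁ (proj₁ q-shortest)) l z≤n l<t)))
      where
      lightOrStrict : ∀ {e} → position e ≡ l → light l ≡ e ⊎ Strict e
      lightOrStrict {e} e-at-l with edgeView e
      ... | light-view l′ = inj₁ (cong light (trans (sym e-at-l) (position-light l′)))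
      ... | heavy-view l′ = inj₂ (heavy-strict (trans (cong (lookup T) (trans (sym (position-heavy l′)) e-at-l)) T[l]))

  module _ {p} (p≤N : p ≤ N) where

    pad : Subset p → Subset N
    pad = padRight p≤N outside

    target : Fin (suc N)
    target = fromℕ< (s≤s p≤N)

    readOff : Subset (N + N) → Subset p
    readOff H = tabulate λ l → not (lookup H (light (inject≤ l p≤N)))

    readOff-shortest : ∀ {S H q} → (∀ e → e ∈ faults (pad S) → e ∉ H) →
                       ShortestIn doubledPath (∁ (faults (pad S))) zero target q → All (_∈ H) q →
                       readOff H ≡ S
    readOff-shortest {S} {H} {q} H-avoids q-shortest q⊆H = trans (tabulate-cong readOff-at) (tabulate∘lookup S)
      where
      pad[l] : ∀ l → lookup (pad S) (inject≤ l p≤N) ≡ lookup S l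
      pad[l] = lookup-padRight p≤N outside S
      l<target : ∀ l → toℕ (inject≤ l p≤N) < toℕ target
      l<target l = subst₂ _<_ (sym (toℕ-inject≤ l p≤N)) (sym (toℕ-fromℕ< (s≤s p≤N))) (toℕ<n l)
      readOff-at : ∀ l → not (lookup H (light (inject≤ l p≤N))) ≡ lookup S l
      readOff-at l with lookup S l in S[l]
      ... | inside  = cong not (lookup-∉ (H-avoids _ (lookup⇒[]= _ _
                        (trans (lookup-faults-light (pad S) _) (trans (pad[l] l) S[l])))))
      ... | outside = cong not ([]=⇒lookup (All.lookup q⊆H
                        (shortest-uses-light (pad S) q-shortest _ (l<target l) (trans (pad[l] l) S[l]))))

    readOff-covering : ∀ {L f k} {𝒢 : Fin k → Subset (N + N)} → IsRPCovering doubledPath L f k 𝒢 → p ≤ L →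
                       ∀ S → ∣ S ∣ ≤ f → ∃ λ i → readOff (𝒢 i) ≡ S
    readOff-covering {L} {f} cov p≤L S ∣S∣≤f =
      let 𝒢F , 𝒢F-avoids , 𝒢F-covers = cov (faults (pad S)) ∣F∣≤f
          i , i∈𝒢F , q , q-shortest , _ , q⊆𝒢i =
            𝒢F-covers zero target (canonical (pad S) target , canonical-shortest (pad S) target , length≤L)
      in i , readOff-shortest (𝒢F-avoids i i∈𝒢F) q-shortest q⊆𝒢i
      where
      ∣F∣≤f : ∣ faults (pad S) ∣ ≤ f
      ∣F∣≤f = ≤-trans (≤-reflexive (trans (∣p++⊥∣≡∣p∣ (pad S)) (∣padRight∣≡∣p∣ p≤N S))) ∣S∣≤f
      length≤L : length (canonical (pad S) target) ≤ L
      length≤L = ≤-trans (≤-reflexive (trans (length-canonical (pad S) target) (toℕ-fromℕ< (s≤s p≤N)))) p≤L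

    atMost≤coveringValue : ∀ {L f k c} {𝒢 : Fin k → Subset (N + N)} → IsRPCovering doubledPath L f k 𝒢 →
                           p ≤ L → c ≤ f → atMost p c ≤ k
    atMost≤coveringValue {k = k} {c} {𝒢} cov p≤L c≤f = injective⇒≤ chosen-injective
      where
      recovered : ∀ i → ∃ λ j → readOff (𝒢 j) ≡ enumAtMost p c i
      recovered i = readOff-covering cov p≤L (enumAtMost p c i) (≤-trans (∣enumAtMost∣≤ p c i) c≤f)
      chosen : Fin (atMost p c) → Fin k
      chosen = proj₁ ∘ recovered
      chosen-injective : Injective _≡_ _≡_ chosen
      chosen-injective {i} {j} eq = enumAtMost-injective p c (begin
        enumAtMost p c i        ≡⟨ proj₂ (recovered i) ⟨
        readOff (𝒢 (chosen i)) ≡⟨ cong (readOff ∘ 𝒢) eq ⟩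
        readOff (𝒢 (chosen j)) ≡⟨ proj₂ (recovered j) ⟩
        enumAtMost p c j        ∎)
        where open ≡-Reasoning

open DoubledPath using (doubledPath; atMost≤coveringValue)

theorem3 : ∀ (n f L : ℕ) → 1 ≤ n → 1 ≤ f → 2 ≤ L →
    Σ (Graph n) λ G →
      ∀ (k : ℕ) (𝒢 : Fin k → Subset (m G)) → IsRPCovering G L f k 𝒢 →
        binomSum L f ⊓ n ≤ k
theorem3 (suc N) (suc c) (suc (suc q)) (s≤s z≤n) (s≤s z≤n) (s≤s (s≤s z≤n)) =
  doubledPath N , λ k 𝒢 cov →
    ≤-trans (Σbinomial⊓suc≤atMost q N c)
            (atMost≤coveringValue N (m⊓n≤n q N) cov (≤-trans (m⊓n≤m q N) (m≤n+m q 2)) (n≤1+n c))
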